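{- There exists a family of Boolean functions $\{g_k:\{0,1\}^{n_k}\to\{0,1\}\mid k\in\mathbb{N}\}$ such that $\mathsf{alt}(g_k)\ge \mathsf{s}(g_k)^{\log_3 5}$ for every $k$, while $\mathsf{DT}(g_k)=\Omega(n_k^{\log_6 3})$.
   Context: For $x,y\in\{0,1\}^n$ write $x\prec y$ if $x_i\le y_i$ for all $i$. A chain is a sequence of distinct inputs $0^n=x_0\prec x_1\prec\dots\prec x_n=1^n$. For a chain $\mathcal C$, $\mathsf{alt}(f,\mathcal C)=|\{i\in[n]: f(x_{i-1})\ne f(x_i)\}|$, and $\mathsf{alt}(f)$ is the maximum of $\mathsf{alt}(f,\mathcal C)$ over all chains. $\mathsf{s}(f)=\max_x|\{i: f(x\oplus e_i)\ne f(x)\}|$ is the sensitivity. $\mathsf{DT}(f)$ is the minimum depth of a deterministic decision tree computing $f$. -}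

module Defs where

open import Data.Nat using (ℕ; zero; suc; _+_; _*_; _^_; _≤_; _⊔_)
open import Data.Bool using (Bool; true; false; not; if_then_else_; _xor_)
open import Data.Bool as B using ()
open import Data.Fin using (Fin; inject₁; fromℕ)
open import Data.Fin using (_≟_)
open import Data.List using (List; []; _∷_; map; foldr; concatMap; allFin)
open import Data.Nat.ListAction using (sum)
open import Data.Vec.Functional as VF using ()
open import Data.Product using (Σ; ∃; _×_)
open import Relation.Nullary using (¬_)
open import Relation.Nullary.Decidable using (⌊_⌋)
open import Relation.Binary.PropositionalEquality using (_≡_; _≢_)

-- Inputs in {0,1}^n, with 0 = false, 1 = true.
Input : ℕ → Set
Input n = Fin n → Bool

BoolFun : ℕ → Set
BoolFun n = Input n → Bool

_≺_ : ∀ {n} → Input n → Input n → Set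
x ≺ y = ∀ j → x j B.≤ y j

flipAt : ∀ {n} → Input n → Fin n → Input n
flipAt x i j = if ⌊ j ≟ i ⌋ then not (x j) else x j

ind : Bool → ℕ
ind true  = 1
ind false = 0

allInputs : (n : ℕ) → List (Input n)
allInputs zero    = (λ ()) ∷ []
allInputs (suc n) = concatMap (λ x → (false VF.∷ x) ∷ (true VF.∷ x) ∷ []) (allInputs n)

sensAt : ∀ {n} → BoolFun n → Input n → ℕ
sensAt {n} f x = sum (map (λ i → ind (f (flipAt x i) xor f x)) (allFin n))

sens : ∀ {n} → BoolFun n → ℕ
sens {n} f = foldr _⊔_ 0 (map (sensAt f) (allInputs n))

-- A chain 0^n = x_0 ≺ x_1 ≺ ... ≺ x_n = 1^n of distinct inputs.
-- (Distinctness of consecutive elements together with ≺ gives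
--  distinctness of all elements.)
record Chain (n : ℕ) : Set where
  field
    pt       : Fin (suc n) → Input n
    start    : ∀ j → pt Data.Fin.zero j ≡ false
    end      : ∀ j → pt (fromℕ n) j ≡ true
    mono     : ∀ (i : Fin n) → pt (inject₁ i) ≺ pt (Data.Fin.suc i)
    distinct : ∀ (i : Fin n) → ¬ (∀ j → pt (inject₁ i) j ≡ pt (Data.Fin.suc i) j)

altChain : ∀ {n} → BoolFun n → Chain n → ℕ
altChain {n} f C =
  sum (map (λ i → ind (f (Chain.pt C (inject₁ i)) xor f (Chain.pt C (Data.Fin.suc i)))) (allFin n))

data DTree (n : ℕ) : Set where
  leaf  : Bool → DTree n
  query : Fin n → DTree n → DTree n → DTree n

evalT : ∀ {n} → DTree n → Input n → Bool
evalT (leaf b)      x = b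
evalT (query i l r) x = if x i then evalT r x else evalT l x

depth : ∀ {n} → DTree n → ℕ
depth (leaf _)      = 0
depth (query _ l r) = suc (depth l ⊔ depth r)

Computes : ∀ {n} → DTree n → BoolFun n → Set
Computes t f = ∀ x → evalT t x ≡ f x

-- For naturals a, s and integers A, B ≥ 2 with log_B A irrational:
--   GeLogPow a s A B   encodes the real inequality   a ≥ s ^ (log_B A).
-- Encoding: for all rationals p/q (p,q ≥ 1) with p/q ≤ log_B A
-- (i.e. B^p ≤ A^q) we have s^(p/q) ≤ a, i.e. s^p ≤ a^q.
GeLogPow : ℕ → ℕ → ℕ → ℕ → Set
GeLogPow a s A B = ∀ p q → 1 ≤ p → 1 ≤ q → B ^ p ≤ A ^ q → s ^ p ≤ a ^ q

-- GeScaledLogPow d cn cd m A B  encodes   d ≥ (cn/cd) · m ^ (log_B A):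
-- for all rationals p/q ≤ log_B A (p,q ≥ 1):  cn^q · m^p ≤ cd^q · d^q.
GeScaledLogPow : ℕ → ℕ → ℕ → ℕ → ℕ → ℕ → Set
GeScaledLogPow d cn cd m A B =
  ∀ p q → 1 ≤ p → 1 ≤ q → B ^ p ≤ A ^ q → cn ^ q * m ^ p ≤ cd ^ q * d ^ q

module Submission where

-- g_0 is the dictator x ↦ x₀ and g_{k+1} = andOr ◇ g_k is the block
-- composition of andOr(x₀,x₁,x₂) = if x₂ then x₀ ∧ x₁ else x₀ ∨ x₁ with g_k.
-- For h on m variables and f on a variables, h ◇ f on m · a variables
-- applies h to the values of f on the m blocks.  Three general laws:
--   * sensitivity is submultiplicative:  s(h ◇ f) ≤ s(f) · s(h);
--   * evasiveness is multiplicative: if h is K-evasive and f is L-evasive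
--     (fewer queries never fix the value), h ◇ f is K·L-evasive, and a
--     K-evasive function needs decision-tree depth ≥ K;
--   * alternation is multiplicative along product chains when h alternates
--     at every step of its own chain and f is unanimous.
-- As andOr has sensitivity 2, is 2-evasive and fully alternating on 3 variables,
-- s(g_k) ≤ 2^k, DT(g_k) ≥ 2^k and alt(g_k) ≥ 3^k.  The exponents then follow
-- from log₃ 5 ≤ 3/2 ≤ log₂ 3 and log₆ 3 ≤ 8/13 ≤ log₃ 2.

open import Data.Bool as Bool using (Bool; true; false; not; _∧_; _∨_; _xor_; if_then_else_)
open import Data.Bool.Properties using (xor-same; ¬-not)
open import Data.Empty using (⊥-elim)
open import Data.Fin as Fin using (Fin; zero; suc; toℕ; combine; remQuot; _↑ˡ_; _↑ʳ_; inject₁)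
open import Data.Fin.Patterns using (0F; 1F; 2F)
open import Data.Fin.Properties using (toℕ-combine; remQuot-combine; combine-remQuot; combine-injective; toℕ-inject₁; toℕ-fromℕ; toℕ<n)
open import Data.List as List using (List; []; _∷_; length; filter; allFin)
open import Data.List.Properties using (filter-accept; filter-reject)
open import Data.List.Membership.Propositional.Properties using (∈-filter⁺; ∈-allFin)
open import Data.List.Relation.Unary.All as All using (All; []; _∷_)
open import Data.Nat
open import Data.Nat.ListAction as ListAction using ()
open import Data.Nat.Properties
open import Algebra.Properties.Semiring.Sum +-*-semiring using (sum; sum-syntax; sum-cong-≗; ∑-distrib-+; *-distribˡ-sum; *-distribʳ-sum)
open import Data.Product using (Σ; _×_; _,_; proj₁; proj₂)
open import Data.Vec.Functional as Vector using ()
open import Function using (_∘_; id)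
open import Relation.Binary.PropositionalEquality
open import Relation.Binary.Definitions using (tri<; tri≈; tri>)
open import Relation.Nullary using (¬_; yes; no)
open import Relation.Nullary.Decidable using (True; toWitness; ⌊_⌋)
open import Defs

sum-mono-≤ : ∀ {n} {φ ψ : Fin n → ℕ} → (∀ i → φ i ≤ ψ i) → sum φ ≤ sum ψ
sum-mono-≤ {zero}  _   = z≤n
sum-mono-≤ {suc n} φ≤ψ = +-mono-≤ (φ≤ψ zero) (sum-mono-≤ (φ≤ψ ∘ suc))

sum-const : ∀ m c → ∑[ j < m ] c ≡ m * c
sum-const zero    c = refl
sum-const (suc m) c = cong (c +_) (sum-const m c)

sum-↑ : ∀ a b (φ : Fin (a + b) → ℕ) → sum φ ≡ ∑[ i < a ] φ (i ↑ˡ b) + ∑[ i < b ] φ (a ↑ʳ i)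
sum-↑ zero    b φ = refl
sum-↑ (suc a) b φ = trans (cong (φ zero +_) (sum-↑ a b (φ ∘ suc))) (sym (+-assoc (φ zero) _ _))

sum-combine : ∀ m a (φ : Fin (m * a) → ℕ) → sum φ ≡ ∑[ j < m ] ∑[ i < a ] φ (combine j i)
sum-combine zero    a φ = refl
sum-combine (suc m) a φ =
  trans (sum-↑ a (m * a) φ) (cong (∑[ i < a ] φ (i ↑ˡ (m * a)) +_) (sum-combine m a (φ ∘ (a ↑ʳ_))))

listSum-tabulate : ∀ {m n} (φ : Fin n → ℕ) (f : Fin m → Fin n) →
  ListAction.sum (List.map φ (List.tabulate f)) ≡ sum (φ ∘ f)
listSum-tabulate {zero}  φ f = refl
listSum-tabulate {suc m} φ f = cong (φ (f zero) +_) (listSum-tabulate φ (f ∘ suc))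

listSum-allFin : ∀ n (φ : Fin n → ℕ) → ListAction.sum (List.map φ (allFin n)) ≡ sum φ
listSum-allFin n φ = listSum-tabulate φ id

count-heavy : ∀ {m} L (φ : Fin m → ℕ) (xs : List (Fin m)) →
  length (filter (λ j → L ≤? φ j) xs) * L ≤ ListAction.sum (List.map φ xs)
count-heavy L φ [] = z≤n
count-heavy L φ (x ∷ xs) with L ≤? φ x
... | yes L≤φx rewrite filter-accept (λ j → L ≤? φ j) {xs = xs} L≤φx =
  +-mono-≤ L≤φx (count-heavy L φ xs)
... | no  L≰φx rewrite filter-reject (λ j → L ≤? φ j) {xs = xs} L≰φx =
  ≤-trans (count-heavy L φ xs) (m≤n+m _ (φ x))

<ᵇ-true : ∀ {m n} → m < n → (m <ᵇ n) ≡ true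
<ᵇ-true {zero}  {suc n} _         = refl
<ᵇ-true {suc m} {suc n} (s≤s m<n) = <ᵇ-true m<n

<ᵇ-false : ∀ {m n} → n ≤ m → (m <ᵇ n) ≡ false
<ᵇ-false {m}     {zero}  _         = refl
<ᵇ-false {suc m} {suc n} (s≤s n≤m) = <ᵇ-false n≤m

<ᵇ-mono : ∀ m t → (m <ᵇ t) Bool.≤ (m <ᵇ suc t)
<ᵇ-mono zero    zero    = Bool.f≤t
<ᵇ-mono zero    (suc t) = Bool.b≤b
<ᵇ-mono (suc m) zero    = Bool.b≤b
<ᵇ-mono (suc m) (suc t) = <ᵇ-mono m t

<ᵇ-cancelˡ-+ : ∀ x v s → (x + v <ᵇ x + s) ≡ (v <ᵇ s)
<ᵇ-cancelˡ-+ zero    v s = refl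
<ᵇ-cancelˡ-+ (suc x) v s = <ᵇ-cancelˡ-+ x v s

xor-≢ : ∀ {u v} → u ≢ v → u xor v ≡ true
xor-≢ {false} {false} u≢v = ⊥-elim (u≢v refl)
xor-≢ {false} {true}  _   = refl
xor-≢ {true}  {false} _   = refl
xor-≢ {true}  {true}  u≢v = ⊥-elim (u≢v refl)

≢-both : ∀ {u w v : Bool} → u ≢ v → w ≢ v → u ≡ w
≢-both u≢v w≢v = trans (¬-not u≢v) (sym (¬-not w≢v))

not-≢ : ∀ b → not b ≢ b
not-≢ true  ()
not-≢ false ()

ind≤1 : ∀ b → ind b ≤ 1
ind≤1 true  = ≤-refl
ind≤1 false = z≤n

<ᵇ-+-ind : ∀ p b → (p <ᵇ p + ind b) ≡ b
<ᵇ-+-ind p true  = <ᵇ-true (≤-reflexive (+-comm 1 p))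
<ᵇ-+-ind p false = <ᵇ-false (≤-reflexive (+-identityʳ p))

-- A ranking orders the n coordinates: rank is a surjection Fin n → Fin n,
-- given together with a section.  Switching the coordinates on in order of
-- increasing rank yields a chain.
record Ranking (n : ℕ) : Set where
  field
    rank        : Fin n → Fin n
    unrank      : Fin n → Fin n
    rank-unrank : ∀ t → rank (unrank t) ≡ t

open Ranking

rankPt : ∀ {n} → Ranking n → ℕ → Input n
rankPt R T i = toℕ (rank R i) <ᵇ T

rankChain : ∀ {n} → Ranking n → Chain n
rankChain {n} R = record
  { pt       = rankPt R ∘ toℕ
  ; start    = λ _ → refl
  ; end      = λ i → trans (cong (toℕ (rank R i) <ᵇ_) (toℕ-fromℕ n)) (<ᵇ-true (toℕ<n (rank R i)))
  ; mono     = λ t i → subst (λ T → (toℕ (rank R i) <ᵇ T) Bool.≤ (toℕ (rank R i) <ᵇ suc (toℕ t)))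
                             (sym (toℕ-inject₁ t)) (<ᵇ-mono (toℕ (rank R i)) (toℕ t))
  ; distinct = distinct
  }
  where
  -- At time t the coordinate of rank t is switched on.
  off : ∀ t → rankPt R (toℕ (inject₁ t)) (unrank R t) ≡ false
  off t = trans (cong₂ (λ r T → toℕ r <ᵇ T) (rank-unrank R t) (toℕ-inject₁ t)) (<ᵇ-false {toℕ t} ≤-refl)
  on : ∀ t → rankPt R (toℕ (suc t)) (unrank R t) ≡ true
  on t = trans (cong (λ r → toℕ r <ᵇ suc (toℕ t)) (rank-unrank R t)) (<ᵇ-true {toℕ t} ≤-refl)
  distinct : ∀ t → ¬ (∀ i → rankPt R (toℕ (inject₁ t)) i ≡ rankPt R (toℕ (suc t)) i)
  distinct t same = not-≢ true (trans (sym (off t)) (trans (same (unrank R t)) (on t)))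

altAlong : ∀ {n} → BoolFun n → Ranking n → ℕ
altAlong {n} f R = ∑[ t < n ] ind (f (rankPt R (toℕ t)) xor f (rankPt R (suc (toℕ t))))

altChain-rankChain : ∀ {n} (f : BoolFun n) (R : Ranking n) → altChain f (rankChain R) ≡ altAlong f R
altChain-rankChain {n} f R = trans (listSum-allFin n _) (sum-cong-≗ {n} λ t →
  cong (λ T → ind (f (rankPt R T) xor f (rankPt R (suc (toℕ t))))) (toℕ-inject₁ t))

idRanking : ∀ {n} → Ranking n
idRanking = record { rank = id ; unrank = id ; rank-unrank = λ _ → refl }

block : ∀ {m a} → Fin m → Input (m * a) → Input a
block j x i = x (combine j i)

glue : ∀ {m a} → (Fin m → Input a) → Input (m * a)
glue {m} {a} ys e = ys (proj₁ (remQuot {m} a e)) (proj₂ (remQuot {m} a e))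

block-glue : ∀ {m a} (ys : Fin m → Input a) (j : Fin m) → block j (glue ys) ≗ ys j
block-glue ys j i = cong (λ p → ys (proj₁ p) (proj₂ p)) (remQuot-combine j i)

-- f respects pointwise equality of inputs (not automatic without function
-- extensionality, so it is carried as a hypothesis).
Extensional : ∀ {n} → BoolFun n → Set
Extensional f = ∀ {x y} → x ≗ y → f x ≡ f y

Unanimous : ∀ {n} → BoolFun n → Set
Unanimous f = ∀ b → f (λ _ → b) ≡ b

_◇_ : ∀ {m a} → BoolFun m → BoolFun a → BoolFun (m * a)
(h ◇ f) x = h (λ j → f (block j x))

◇-extensional : ∀ {m a} {h : BoolFun m} {f : BoolFun a} →
  Extensional h → Extensional f → Extensional (h ◇ f)
◇-extensional ext-h ext-f x≗y = ext-h λ j → ext-f λ i → x≗y (combine j i)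

◇-unanimous : ∀ {m a} {h : BoolFun m} {f : BoolFun a} →
  Extensional h → Unanimous h → Unanimous f → Unanimous (h ◇ f)
◇-unanimous ext-h unanimous-h unanimous-f b = trans (ext-h λ j → unanimous-f b) (unanimous-h b)

block-flip-same : ∀ {m a} (x : Input (m * a)) (j : Fin m) (i : Fin a) →
  block j (flipAt x (combine j i)) ≗ flipAt (block j x) i
block-flip-same x j i i′ with combine j i′ Fin.≟ combine j i | i′ Fin.≟ i
... | yes _     | yes _     = refl
... | yes same  | no  i′≢i = ⊥-elim (i′≢i (proj₂ (combine-injective j i′ j i same)))
... | no  diff  | yes refl  = ⊥-elim (diff refl)
... | no  _     | no  _     = refl

block-flip-other : ∀ {m a} (x : Input (m * a)) {j j′ : Fin m} (i : Fin a) → j′ ≢ j →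
  block j′ (flipAt x (combine j i)) ≗ block j′ x
block-flip-other x {j} {j′} i j′≢j i′ with combine j′ i′ Fin.≟ combine j i
... | yes same = ⊥-elim (j′≢j (proj₁ (combine-injective j′ i′ j i same)))
... | no  _    = refl

change-one : ∀ {m} {h : BoolFun m} → Extensional h → (v w : Input m) (j : Fin m) →
  (∀ j′ → j′ ≢ j → w j′ ≡ v j′) →
  ind (h w xor h v) ≤ ind (w j xor v j) * ind (h (flipAt v j) xor h v)
change-one {h = h} ext-h v w j others with w j Bool.≟ v j
... | yes wj≡vj = ≤-trans (≤-reflexive (cong ind unchanged)) z≤n
  where
  w≗v : w ≗ v
  w≗v j′ with j′ Fin.≟ j
  ... | yes refl  = wj≡vj
  ... | no  j′≢j  = others j′ j′≢j
  unchanged : h w xor h v ≡ false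
  unchanged = trans (cong (_xor h v) (ext-h w≗v)) (xor-same (h v))
... | no  wj≢vj = ≤-reflexive (begin
  ind (h w xor h v)                                       ≡⟨ cong (λ u → ind (u xor h v)) (ext-h w≗flip) ⟩
  ind (h (flipAt v j) xor h v)                            ≡⟨ sym (+-identityʳ _) ⟩
  1 * ind (h (flipAt v j) xor h v)                        ≡⟨ cong (λ b → ind b * _) (sym (xor-≢ wj≢vj)) ⟩
  ind (w j xor v j) * ind (h (flipAt v j) xor h v)        ∎)
  where
  open ≡-Reasoning
  w≗flip : w ≗ flipAt v j
  w≗flip j′ with j′ Fin.≟ j
  ... | yes refl  = ¬-not wj≢vj
  ... | no  j′≢j  = others j′ j′≢j

-- Sensitivity of a block composition: each sensitive coordinate of h at the
-- block values contributes at most K sensitive positions (K bounds the sensitivity of f).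
sensAt-◇ : ∀ {m a} {h : BoolFun m} {f : BoolFun a} → Extensional h → Extensional f →
  ∀ {K} → (∀ y → sensAt f y ≤ K) → ∀ x → sensAt (h ◇ f) x ≤ K * sensAt h (λ j → f (block j x))
sensAt-◇ {m} {a} {h} {f} ext-h ext-f {K} sens-f≤K x = begin
  sensAt (h ◇ f) x
    ≡⟨ trans (listSum-allFin (m * a) _) (sum-combine m a _) ⟩
  ∑[ j < m ] ∑[ i < a ] ind ((h ◇ f) (flipAt x (combine j i)) xor h v)
    ≤⟨ sum-mono-≤ (λ j → sum-mono-≤ (λ i → change-one ext-h v (w j i) j (others j i))) ⟩
  ∑[ j < m ] ∑[ i < a ] (ind (f (block j (flipAt x (combine j i))) xor v j) * c j)
    ≡⟨ sum-cong-≗ {m} (λ j → sym (*-distribʳ-sum {a} (c j) (λ i →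
          ind (f (block j (flipAt x (combine j i))) xor v j)))) ⟩
  ∑[ j < m ] (∑[ i < a ] ind (f (block j (flipAt x (combine j i))) xor v j) * c j)
    ≡⟨ sum-cong-≗ {m} (λ j → cong (_* c j) (trans (sum-cong-≗ {a} λ i →
          cong (λ u → ind (u xor v j)) (ext-f (block-flip-same x j i)))
          (sym (listSum-allFin a _)))) ⟩
  ∑[ j < m ] (sensAt f (block j x) * c j)
    ≤⟨ sum-mono-≤ (λ j → *-monoˡ-≤ (c j) (sens-f≤K (block j x))) ⟩
  ∑[ j < m ] (K * c j)
    ≡⟨ sym (*-distribˡ-sum K c) ⟩
  K * ∑[ j < m ] c j
    ≡⟨ cong (K *_) (sym (listSum-allFin m c)) ⟩
  K * sensAt h v ∎
  where
  open ≤-Reasoning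
  v : Input m
  v j = f (block j x)
  c : Fin m → ℕ
  c j = ind (h (flipAt v j) xor h v)
  w : Fin m → Fin a → Input m
  w j i j′ = f (block j′ (flipAt x (combine j i)))
  others : ∀ j i j′ → j′ ≢ j → w j i j′ ≡ v j′
  others j i j′ j′≢j = ext-f (block-flip-other x i j′≢j)

sens-≤ : ∀ {n} {f : BoolFun n} {B} → (∀ x → sensAt f x ≤ B) → sens f ≤ B
sens-≤ {n} {f} {B} sensAt≤B = bound (allInputs n)
  where
  bound : ∀ xs → List.foldr _⊔_ 0 (List.map (sensAt f) xs) ≤ B
  bound []       = z≤n
  bound (x ∷ xs) = ⊔-lub (sensAt≤B x) (bound xs)

Agree : ∀ {n} → List (Fin n) → Input n → Input n → Set
Agree S x y = All (λ i → x i ≡ y i) S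

agree-refl : ∀ {n} (S : List (Fin n)) (x : Input n) → Agree S x x
agree-refl S x = All.tabulate (λ _ → refl)

Evasive : ∀ {n} → ℕ → BoolFun n → Set
Evasive {n} K f = ∀ x (S : List (Fin n)) → length S < K → Σ (Input n) λ y → Agree S x y × f y ≢ f x

query-follows : ∀ {n} (i : Fin n) (l r : DTree n) (y : Input n) {b} → y i ≡ b →
  evalT (query i l r) y ≡ evalT (if b then r else l) y
query-follows i l r y refl with y i
... | true  = refl
... | false = refl

branch-correct : ∀ {n} {f : BoolFun n} (i : Fin n) (l r : DTree n) (x : Input n) (S : List (Fin n)) →
  (∀ y → Agree S x y → evalT (query i l r) y ≡ f y) →
  ∀ {b} → x i ≡ b → ∀ y → Agree (i ∷ S) x y → evalT (if b then r else l) y ≡ f y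
branch-correct i l r x S correct xi≡b y (xi≡yi ∷ x≈y) =
  trans (sym (query-follows i l r y (trans (sym xi≡yi) xi≡b))) (correct y x≈y)

descend : ∀ {K d e s} → d ≤ e → K ≤ d + suc s → K ≤ suc e + s
descend {d = d} {s = s} d≤e K≤ =
  ≤-trans K≤ (≤-trans (≤-reflexive (+-suc d s)) (s≤s (+-monoˡ-≤ s d≤e)))

-- Adversary argument: if t computes f on every input agreeing with x on the
-- already queried positions S, then t makes at least K - |S| further queries.
queries-≥ : ∀ {n K} {f : BoolFun n} → Evasive K f → (t : DTree n) (x : Input n) (S : List (Fin n)) →
  (∀ y → Agree S x y → evalT t y ≡ f y) → K ≤ depth t + length S
queries-≥ {K = K} evasive (leaf b) x S correct with K ≤? length S
... | yes K≤|S| = K≤|S|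
... | no  K≰|S| with evasive x S (≰⇒> K≰|S|)
...   | y , x≈y , fy≢fx = ⊥-elim (fy≢fx (trans (sym (correct y x≈y)) (correct x (agree-refl S x))))
queries-≥ evasive (query i l r) x S correct with x i in xi≡b
... | true  = descend (m≤n⊔m (depth l) (depth r))
                      (queries-≥ evasive r x (i ∷ S) (branch-correct i l r x S correct xi≡b))
... | false = descend (m≤m⊔n (depth l) (depth r))
                      (queries-≥ evasive l x (i ∷ S) (branch-correct i l r x S correct xi≡b))

depth-≥ : ∀ {n K} {f : BoolFun n} → Evasive K f → (t : DTree n) → Computes t f → K ≤ depth t
depth-≥ evasive t computes =
  subst (_ ≤_) (+-identityʳ (depth t)) (queries-≥ evasive t (λ _ → false) [] (λ y _ → computes y))

addIfIn : ∀ {m a} → Fin m → Fin m × Fin a → List (Fin a) → List (Fin a)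
addIfIn j (j′ , i) rest = if ⌊ j′ Fin.≟ j ⌋ then i ∷ rest else rest

blockQueries : ∀ {m a} → Fin m → List (Fin (m * a)) → List (Fin a)
blockQueries         j []      = []
blockQueries {m} {a} j (e ∷ S) = addIfIn j (remQuot {m} a e) (blockQueries j S)

length-addIfIn : ∀ {m a} (j j′ : Fin m) (i : Fin a) rest →
  length (addIfIn j (j′ , i) rest) ≡ ind ⌊ j′ Fin.≟ j ⌋ + length rest
length-addIfIn j j′ i rest with j′ Fin.≟ j
... | yes _ = refl
... | no  _ = refl

sum-ind-≟ : ∀ {m} (j′ : Fin m) → ∑[ j < m ] ind ⌊ j′ Fin.≟ j ⌋ ≡ 1
sum-ind-≟ {suc m} zero      = cong suc (trans (sum-const m 0) (*-zeroʳ m))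
sum-ind-≟ {suc m} (suc j′)  = trans (sum-cong-≗ {m} (ind-≟-suc j′)) (sum-ind-≟ j′)
  where
  ind-≟-suc : ∀ {m} (j′ j : Fin m) → ind ⌊ suc j′ Fin.≟ suc j ⌋ ≡ ind ⌊ j′ Fin.≟ j ⌋
  ind-≟-suc j′ j with j′ Fin.≟ j
  ... | yes _ = refl
  ... | no  _ = refl

length-blockQueries : ∀ {m a} (S : List (Fin (m * a))) →
  ∑[ j < m ] length (blockQueries {m} {a} j S) ≡ length S
length-blockQueries {m} [] = trans (sum-const m 0) (*-zeroʳ m)
length-blockQueries {m} {a} (e ∷ S) = begin
  ∑[ j < m ] length (blockQueries j (e ∷ S))
    ≡⟨ sum-cong-≗ {m} (λ j → length-addIfIn j j′ i (blockQueries j S)) ⟩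
  ∑[ j < m ] (ind ⌊ j′ Fin.≟ j ⌋ + length (blockQueries j S))
    ≡⟨ ∑-distrib-+ (λ j → ind ⌊ j′ Fin.≟ j ⌋) (λ j → length (blockQueries j S)) ⟩
  ∑[ j < m ] ind ⌊ j′ Fin.≟ j ⌋ + ∑[ j < m ] length (blockQueries j S)
    ≡⟨ cong₂ _+_ (sum-ind-≟ j′) (length-blockQueries {m} {a} S) ⟩
  suc (length S) ∎
  where
  open ≡-Reasoning
  j′ : Fin m
  j′ = proj₁ (remQuot {m} a e)
  i : Fin a
  i = proj₂ (remQuot {m} a e)

All-addIfIn-tail : ∀ {m a} {P : Fin a → Set} j (p : Fin m × Fin a) rest →
  All P (addIfIn j p rest) → All P rest
All-addIfIn-tail j (j′ , i) rest all with j′ Fin.≟ j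
... | yes _ = All.tail all
... | no  _ = all

All-addIfIn-head : ∀ {m a} {P : Fin a → Set} (j : Fin m) i rest → All P (addIfIn j (j , i) rest) → P i
All-addIfIn-head j i rest all with j Fin.≟ j
... | yes _   = All.head all
... | no  j≢j = ⊥-elim (j≢j refl)

agree-blocks : ∀ {m a} (S : List (Fin (m * a))) (x y : Input (m * a)) →
  (∀ (j : Fin m) → Agree (blockQueries {m} {a} j S) (block j x) (block j y)) → Agree S x y
agree-blocks         []      x y _          = []
agree-blocks {m} {a} (e ∷ S) x y agree-each =
  subst (λ e′ → x e′ ≡ y e′) (combine-remQuot {m} a e)
        (All-addIfIn-head j′ i (blockQueries {m} {a} j′ S) (agree-each j′))
  ∷ agree-blocks S x y (λ j → All-addIfIn-tail j (remQuot {m} a e) (blockQueries {m} {a} j S) (agree-each j))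
  where
  j′ : Fin m
  j′ = proj₁ (remQuot {m} a e)
  i : Fin a
  i = proj₂ (remQuot {m} a e)

-- Fewer than K·L queries
-- leave fewer than K blocks with at least L queries; the K-evasive h can be
-- flipped by changing only the other (lightly queried) blocks, and each of
-- those can be given any value because f is L-evasive.
◇-evasive : ∀ {m a K L} {h : BoolFun m} {f : BoolFun a} → Extensional h → Extensional f →
  Evasive K h → Evasive L f → Evasive (K * L) (h ◇ f)
◇-evasive {m} {a} {K} {L} {h} {f} ext-h ext-f evasive-h evasive-f x S |S|<KL =
  glue y , agree , differs
  where
  v : Input m
  v j = f (block j x)
  ℓ : Fin m → ℕ
  ℓ j = length (blockQueries {m} {a} j S)
  heavy : List (Fin m)
  heavy = filter (λ j → L ≤? ℓ j) (allFin m)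
  few-heavy : length heavy < K
  few-heavy = *-cancelʳ-< L (length heavy) K (begin-strict
    length heavy * L                      ≤⟨ count-heavy L ℓ (allFin m) ⟩
    ListAction.sum (List.map ℓ (allFin m)) ≡⟨ listSum-allFin m ℓ ⟩
    ∑[ j < m ] ℓ j                         ≡⟨ length-blockQueries {m} {a} S ⟩
    length S                               <⟨ |S|<KL ⟩
    K * L                                  ∎)
    where open ≤-Reasoning
  flip-h : Σ (Input m) λ w → Agree heavy v w × h w ≢ h v
  flip-h = evasive-h v heavy few-heavy
  w : Input m
  w = proj₁ flip-h
  reach : ∀ j → Σ (Input a) λ yj → Agree (blockQueries j S) (block j x) yj × f yj ≡ w j
  reach j with w j Bool.≟ v j
  ... | yes wj≡vj = block j x , agree-refl _ _ , sym wj≡vj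
  ... | no  wj≢vj with L ≤? ℓ j
  ...   | yes j-heavy = ⊥-elim (wj≢vj (sym (All.lookup (proj₁ (proj₂ flip-h))
                                            (∈-filter⁺ (λ j → L ≤? ℓ j) (∈-allFin j) j-heavy))))
  ...   | no  j-light with evasive-f (block j x) (blockQueries j S) (≰⇒> j-light)
  ...     | yj , agree-j , fyj≢vj = yj , agree-j , ≢-both fyj≢vj wj≢vj
  y : Fin m → Input a
  y j = proj₁ (reach j)
  agree : Agree S x (glue y)
  agree = agree-blocks S x (glue y) λ j →
    All.map (λ {i} xi≡yi → trans xi≡yi (sym (block-glue y j i))) (proj₁ (proj₂ (reach j)))
  differs : (h ◇ f) (glue y) ≢ (h ◇ f) x
  differs = subst (_≢ h v) (sym (ext-h λ j → trans (ext-f (block-glue y j)) (proj₂ (proj₂ (reach j)))))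
                  (proj₂ (proj₂ flip-h))

mapBlocks : ∀ {m a} → (Fin m → Fin m) → (Fin a → Fin a) → Fin (m * a) → Fin (m * a)
mapBlocks {m} {a} φ ψ e = combine (φ (proj₁ (remQuot {m} a e))) (ψ (proj₂ (remQuot {m} a e)))

mapBlocks-combine : ∀ {m a} (φ : Fin m → Fin m) (ψ : Fin a → Fin a) j i →
  mapBlocks φ ψ (combine j i) ≡ combine (φ j) (ψ i)
mapBlocks-combine {m} {a} φ ψ j i =
  cong (λ p → combine (φ (proj₁ p)) (ψ (proj₂ p))) (remQuot-combine {m} {a} j i)

mapBlocks-inverse : ∀ {m a} {φ φ′ : Fin m → Fin m} {ψ ψ′ : Fin a → Fin a} →
  (∀ j → φ (φ′ j) ≡ j) → (∀ i → ψ (ψ′ i) ≡ i) → ∀ t → mapBlocks φ ψ (mapBlocks φ′ ψ′ t) ≡ t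
mapBlocks-inverse {m} {a} {φ} {φ′} {ψ} {ψ′} φφ′ ψψ′ t = begin
  mapBlocks φ ψ (combine (φ′ j) (ψ′ i)) ≡⟨ mapBlocks-combine φ ψ (φ′ j) (ψ′ i) ⟩
  combine (φ (φ′ j)) (ψ (ψ′ i))         ≡⟨ cong₂ combine (φφ′ j) (ψψ′ i) ⟩
  combine j i                           ≡⟨ combine-remQuot {m} a t ⟩
  t                                     ∎
  where
  open ≡-Reasoning
  j : Fin m
  j = proj₁ (remQuot {m} a t)
  i : Fin a
  i = proj₂ (remQuot {m} a t)

-- The product ranking of m blocks of size a: blocks are ordered by σ and
-- positions inside each block by ρ, lexicographically.
_⊗_ : ∀ {m a} → Ranking m → Ranking a → Ranking (m * a)
σ ⊗ ρ = record
  { rank        = mapBlocks (rank σ) (rank ρ)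
  ; unrank      = mapBlocks (unrank σ) (unrank ρ)
  ; rank-unrank = mapBlocks-inverse {φ = rank σ} {ψ = rank ρ} (rank-unrank σ) (rank-unrank ρ)
  }

toℕ-rank-⊗ : ∀ {m a} (σ : Ranking m) (ρ : Ranking a) j i →
  toℕ (rank (σ ⊗ ρ) (combine j i)) ≡ a * toℕ (rank σ j) + toℕ (rank ρ i)
toℕ-rank-⊗ σ ρ j i =
  trans (cong toℕ (mapBlocks-combine (rank σ) (rank ρ) j i)) (toℕ-combine (rank σ j) (rank ρ i))

lex-< : ∀ a {r p t} s → t < a → r < p → a * r + t < a * p + s
lex-< a {r} {p} {t} s t<a r<p = begin-strict
  a * r + t   <⟨ +-monoʳ-< (a * r) t<a ⟩
  a * r + a   ≡⟨ trans (+-comm (a * r) a) (sym (*-suc a r)) ⟩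
  a * suc r   ≤⟨ *-monoʳ-≤ a r<p ⟩
  a * p       ≤⟨ m≤m+n (a * p) s ⟩
  a * p + s   ∎
  where open ≤-Reasoning

lex-≥ : ∀ a {r p s} t → s ≤ a → p < r → a * p + s ≤ a * r + t
lex-≥ a {r} {p} {s} t s≤a p<r = begin
  a * p + s   ≤⟨ +-monoʳ-≤ (a * p) s≤a ⟩
  a * p + a   ≡⟨ trans (+-comm (a * p) a) (sym (*-suc a p)) ⟩
  a * suc p   ≤⟨ *-monoʳ-≤ a p<r ⟩
  a * r       ≤⟨ m≤m+n (a * r) t ⟩
  a * r + t   ∎
  where open ≤-Reasoning

-- At time a·p + s of the product chain (s ≤ a) the blocks of rank below p
-- are full, those of rank above p are empty, and the block of rank p is at
-- time s of its own chain.  So the block values of f are the point of σ's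
-- chain at time p or p + 1, according to the value of f at time s.
◇-rankPt : ∀ {m a} {h : BoolFun m} {f : BoolFun a} → Extensional h → Extensional f → Unanimous f →
  (σ : Ranking m) (ρ : Ranking a) (p : ℕ) {s : ℕ} → s ≤ a →
  (h ◇ f) (rankPt (σ ⊗ ρ) (a * p + s)) ≡ h (rankPt σ (p + ind (f (rankPt ρ s))))
◇-rankPt {m} {a} {h} {f} ext-h ext-f unanimous-f σ ρ p {s} s≤a = ext-h block-value
  where
  x : Input (m * a)
  x = rankPt (σ ⊗ ρ) (a * p + s)
  b : Bool
  b = f (rankPt ρ s)
  at : ∀ j i → block j x i ≡ (a * toℕ (rank σ j) + toℕ (rank ρ i) <ᵇ a * p + s)
  at j i = cong (_<ᵇ a * p + s) (toℕ-rank-⊗ σ ρ j i)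
  block-value : ∀ j → f (block j x) ≡ (toℕ (rank σ j) <ᵇ p + ind b)
  block-value j with <-cmp (toℕ (rank σ j)) p
  ... | tri< r<p _ _ = begin
    f (block j x)               ≡⟨ ext-f (λ i → trans (at j i) (<ᵇ-true (lex-< a s (toℕ<n (rank ρ i)) r<p))) ⟩
    f (λ _ → true)              ≡⟨ unanimous-f true ⟩
    true                        ≡⟨ sym (<ᵇ-true (≤-trans r<p (m≤m+n p (ind b)))) ⟩
    (toℕ (rank σ j) <ᵇ p + ind b) ∎
    where open ≡-Reasoning
  ... | tri> _ _ p<r = begin
    f (block j x)               ≡⟨ ext-f (λ i → trans (at j i) (<ᵇ-false (lex-≥ a (toℕ (rank ρ i)) s≤a p<r))) ⟩
    f (λ _ → false)             ≡⟨ unanimous-f false ⟩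
    false                       ≡⟨ sym (<ᵇ-false (≤-trans (+-monoʳ-≤ p (ind≤1 b))
                                                          (≤-trans (≤-reflexive (+-comm p 1)) p<r))) ⟩
    (toℕ (rank σ j) <ᵇ p + ind b) ∎
    where open ≡-Reasoning
  ... | tri≈ _ r≡p _ = begin
    f (block j x)               ≡⟨ ext-f (λ i → trans (at j i) (trans (cong (λ r → a * r + _ <ᵇ a * p + s) r≡p)
                                                                      (<ᵇ-cancelˡ-+ (a * p) _ s))) ⟩
    b                           ≡⟨ sym (<ᵇ-+-ind p b) ⟩
    (p <ᵇ p + ind b)            ≡⟨ cong (_<ᵇ p + ind b) (sym r≡p) ⟩
    (toℕ (rank σ j) <ᵇ p + ind b) ∎
    where open ≡-Reasoning

FullyAlternating : ∀ {m} → BoolFun m → Ranking m → Set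
FullyAlternating {m} h σ = ∀ (p : Fin m) → h (rankPt σ (toℕ p)) ≢ h (rankPt σ (suc (toℕ p)))

alternating-step : ∀ {m} (h : BoolFun m) (σ : Ranking m) p → h (rankPt σ p) ≢ h (rankPt σ (suc p)) →
  ∀ b b′ → ind (h (rankPt σ (p + ind b)) xor h (rankPt σ (p + ind b′))) ≡ ind (b xor b′)
alternating-step h σ p step false false rewrite xor-same (h (rankPt σ (p + 0))) = refl
alternating-step h σ p step true  true  rewrite xor-same (h (rankPt σ (p + 1))) = refl
alternating-step h σ p step false true  rewrite +-identityʳ p | +-comm p 1 = cong ind (xor-≢ step)
alternating-step h σ p step true  false rewrite +-identityʳ p | +-comm p 1 = cong ind (xor-≢ (step ∘ sym))

-- Alternation multiplies under block composition: along the product chain,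
-- every step of the chain of f inside the current block changes h ◇ f.
altAlong-◇ : ∀ {m a} {h : BoolFun m} {f : BoolFun a} → Extensional h → Extensional f → Unanimous f →
  (σ : Ranking m) (ρ : Ranking a) → FullyAlternating h σ → altAlong (h ◇ f) (σ ⊗ ρ) ≡ m * altAlong f ρ
altAlong-◇ {m} {a} {h} {f} ext-h ext-f unanimous-f σ ρ alternating = begin
  altAlong (h ◇ f) (σ ⊗ ρ)
    ≡⟨ sum-combine m a _ ⟩
  ∑[ p < m ] ∑[ s < a ] change (toℕ (combine p s))
    ≡⟨ sum-cong-≗ {m} (λ p → sum-cong-≗ {a} (λ s → change-in-block p s)) ⟩
  ∑[ p < m ] altAlong f ρ
    ≡⟨ sum-const m (altAlong f ρ) ⟩
  m * altAlong f ρ ∎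
  where
  open ≡-Reasoning
  change : ℕ → ℕ
  change T = ind ((h ◇ f) (rankPt (σ ⊗ ρ) T) xor (h ◇ f) (rankPt (σ ⊗ ρ) (suc T)))
  fAt : ℕ → Bool
  fAt s = f (rankPt ρ s)
  change-in-block : ∀ p s → change (toℕ (combine p s)) ≡ ind (fAt (toℕ s) xor fAt (suc (toℕ s)))
  change-in-block p s = begin
    change (toℕ (combine p s))
      ≡⟨ cong change (toℕ-combine p s) ⟩
    change (a * toℕ p + toℕ s)
      ≡⟨ cong₂ (λ u w → ind (u xor (h ◇ f) (rankPt (σ ⊗ ρ) w)))
               (◇-rankPt ext-h ext-f unanimous-f σ ρ (toℕ p) (<⇒≤ (toℕ<n s)))
               (sym (+-suc (a * toℕ p) (toℕ s))) ⟩
    ind (h (rankPt σ (toℕ p + ind (fAt (toℕ s)))) xor (h ◇ f) (rankPt (σ ⊗ ρ) (a * toℕ p + suc (toℕ s))))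
      ≡⟨ cong (λ u → ind (h (rankPt σ (toℕ p + ind (fAt (toℕ s)))) xor u))
              (◇-rankPt ext-h ext-f unanimous-f σ ρ (toℕ p) (toℕ<n s)) ⟩
    ind (h (rankPt σ (toℕ p + ind (fAt (toℕ s)))) xor h (rankPt σ (toℕ p + ind (fAt (suc (toℕ s))))))
      ≡⟨ alternating-step h σ (toℕ p) (alternating p) (fAt (toℕ s)) (fAt (suc (toℕ s))) ⟩
    ind (fAt (toℕ s) xor fAt (suc (toℕ s))) ∎

^-swap : ∀ x m n → (x ^ m) ^ n ≡ (x ^ n) ^ m
^-swap x m n = trans (^-*-assoc x m n) (trans (cong (x ^_) (*-comm m n)) (sym (^-*-assoc x n m)))

^-cancelʳ-≤ : ∀ b {m n} → 1 < b → b ^ m ≤ b ^ n → m ≤ n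
^-cancelʳ-≤ b {m} {n} 1<b bᵐ≤bⁿ with m ≤? n
... | yes m≤n = m≤n
... | no  m≰n = ⊥-elim (<⇒≱ (^-monoʳ-< b 1<b (≰⇒> m≰n)) bᵐ≤bⁿ)

^-cancelˡ-≤ : ∀ e .{{_ : NonZero e}} {x y} → x ^ e ≤ y ^ e → x ≤ y
^-cancelˡ-≤ e {x} {y} xᵉ≤yᵉ with x ≤? y
... | yes x≤y = x≤y
... | no  x≰y = ⊥-elim (<⇒≱ (^-monoˡ-< e (≰⇒> x≰y)) xᵉ≤yᵉ)

-- Comparison of logarithms through an intermediate fraction v/u: if
-- p/q ≤ log_B A ≤ v/u ≤ log_C D then p/q ≤ log_C D.  Multiplicatively:
-- B^p ≤ A^q, A^u ≤ B^v and C^v ≤ D^u give C^p ≤ D^q.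
log-≤-via : ∀ {A B C D} u v .{{_ : NonZero v}} .{{_ : NonZero D}} → 1 < B →
  A ^ u ≤ B ^ v → C ^ v ≤ D ^ u → ∀ {p q} → B ^ p ≤ A ^ q → C ^ p ≤ D ^ q
log-≤-via {A} {B} {C} {D} u v 1<B Aᵘ≤Bᵛ Cᵛ≤Dᵘ {p} {q} Bᵖ≤Aᵠ = ^-cancelˡ-≤ v (begin
  (C ^ p) ^ v  ≡⟨ ^-swap C p v ⟩
  (C ^ v) ^ p  ≤⟨ ^-monoˡ-≤ p Cᵛ≤Dᵘ ⟩
  (D ^ u) ^ p  ≡⟨ ^-*-assoc D u p ⟩
  D ^ (u * p)  ≤⟨ ^-monoʳ-≤ D (≤-trans (≤-reflexive (*-comm u p)) pu≤vq) ⟩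
  D ^ (v * q)  ≡⟨ trans (cong (D ^_) (*-comm v q)) (sym (^-*-assoc D q v)) ⟩
  (D ^ q) ^ v  ∎)
  where
  open ≤-Reasoning
  pu≤vq : p * u ≤ v * q
  pu≤vq = ^-cancelʳ-≤ B 1<B (begin
    B ^ (p * u)  ≡⟨ sym (^-*-assoc B p u) ⟩
    (B ^ p) ^ u  ≤⟨ ^-monoˡ-≤ u Bᵖ≤Aᵠ ⟩
    (A ^ q) ^ u  ≡⟨ ^-swap A q u ⟩
    (A ^ u) ^ q  ≤⟨ ^-monoˡ-≤ q Aᵘ≤Bᵛ ⟩
    (B ^ v) ^ q  ≡⟨ ^-*-assoc B v q ⟩
    B ^ (v * q)  ∎)

by-evaluation : ∀ {m n} {m≤n : True (m ≤? n)} → m ≤ n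
by-evaluation {m≤n = m≤n} = toWitness m≤n

-- log₃ 5 ≤ 3/2 ≤ log₂ 3.
below-log₃5⇒below-log₂3 : ∀ p q → 3 ^ p ≤ 5 ^ q → 2 ^ p ≤ 3 ^ q
below-log₃5⇒below-log₂3 p q =
  log-≤-via {A = 5} {B = 3} {C = 2} {D = 3} 2 3 by-evaluation by-evaluation by-evaluation {p} {q}

-- log₆ 3 ≤ 8/13 ≤ log₃ 2.
below-log₆3⇒below-log₃2 : ∀ p q → 6 ^ p ≤ 3 ^ q → 3 ^ p ≤ 2 ^ q
below-log₆3⇒below-log₃2 p q =
  log-≤-via {A = 3} {B = 6} {C = 3} {D = 2} 13 8 by-evaluation by-evaluation by-evaluation {p} {q}

power-sandwich : ∀ A D k p q {s t} → A ^ p ≤ D ^ q → s ≤ A ^ k → D ^ k ≤ t → s ^ p ≤ t ^ q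
power-sandwich A D k p q {s} {t} Aᵖ≤Dᵠ s≤Aᵏ Dᵏ≤t = begin
  s ^ p        ≤⟨ ^-monoˡ-≤ p s≤Aᵏ ⟩
  (A ^ k) ^ p  ≡⟨ ^-swap A k p ⟩
  (A ^ p) ^ k  ≤⟨ ^-monoˡ-≤ k Aᵖ≤Dᵠ ⟩
  (D ^ q) ^ k  ≡⟨ ^-swap D q k ⟩
  (D ^ k) ^ q  ≤⟨ ^-monoˡ-≤ q Dᵏ≤t ⟩
  t ^ q        ∎
  where open ≤-Reasoning

dictator : BoolFun 1
dictator x = x zero

dictator-extensional : Extensional dictator
dictator-extensional x≗y = x≗y zero

dictator-unanimous : Unanimous dictator
dictator-unanimous b = refl

dictator-sensAt : ∀ x → sensAt dictator x ≤ 1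
dictator-sensAt x with x zero
... | true  = ≤-refl
... | false = ≤-refl

dictator-evasive : Evasive 1 dictator
dictator-evasive x []      _         = (λ _ → not (x zero)) , [] , not-≢ (x zero)
dictator-evasive x (_ ∷ _) (s≤s ())

dictator-alt : altAlong dictator idRanking ≡ 1
dictator-alt = refl

andOr : BoolFun 3
andOr x = if x 2F then x 0F ∧ x 1F else x 0F ∨ x 1F

andOr-extensional : Extensional andOr
andOr-extensional {x} {y} x≗y =
  trans (cong (λ c → if c then x 0F ∧ x 1F else x 0F ∨ x 1F) (x≗y 2F))
        (cong₂ (λ a b → if y 2F then a ∧ b else a ∨ b) (x≗y 0F) (x≗y 1F))

andOr-unanimous : Unanimous andOr
andOr-unanimous true  = refl
andOr-unanimous false = refl

andOr-sensAt : ∀ x → sensAt andOr x ≤ 2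
andOr-sensAt x with x 0F | x 1F | x 2F
... | false | false | false = by-evaluation
... | false | false | true  = by-evaluation
... | false | true  | false = by-evaluation
... | false | true  | true  = by-evaluation
... | true  | false | false = by-evaluation
... | true  | false | true  = by-evaluation
... | true  | true  | false = by-evaluation
... | true  | true  | true  = by-evaluation

-- Whatever coordinate j is fixed, the other two can force any value t.
force : Fin 3 → Input 3 → Bool → Input 3
force 0F x t = x 0F Vector.∷ t      Vector.∷ not t Vector.∷ Vector.[]
force 1F x t = t    Vector.∷ x 1F   Vector.∷ not t Vector.∷ Vector.[]
force 2F x t = t    Vector.∷ t      Vector.∷ x 2F  Vector.∷ Vector.[]

force-keeps : ∀ j x t → force j x t j ≡ x j
force-keeps 0F x t = refl
force-keeps 1F x t = refl
force-keeps 2F x t = refl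

andOr-force : ∀ j x t → andOr (force j x t) ≡ t
andOr-force 0F x t = first-forced (x 0F) t
  where
  first-forced : ∀ a t → (if not t then a ∧ t else a ∨ t) ≡ t
  first-forced false false = refl
  first-forced false true  = refl
  first-forced true  false = refl
  first-forced true  true  = refl
andOr-force 1F x t = second-forced (x 1F) t
  where
  second-forced : ∀ b t → (if not t then t ∧ b else t ∨ b) ≡ t
  second-forced b false = refl
  second-forced b true  = refl
andOr-force 2F x t = selector-forced (x 2F) t
  where
  selector-forced : ∀ c t → (if c then t ∧ t else t ∨ t) ≡ t
  selector-forced false false = refl
  selector-forced false true  = refl
  selector-forced true  false = refl
  selector-forced true  true  = refl

andOr-flips : ∀ j x → andOr (force j x (not (andOr x))) ≢ andOr x
andOr-flips j x = subst (_≢ andOr x) (sym (andOr-force j x _)) (not-≢ (andOr x))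

andOr-evasive : Evasive 2 andOr
andOr-evasive x []          _              = force 0F x (not (andOr x)) , [] , andOr-flips 0F x
andOr-evasive x (j ∷ [])    _              =
  force j x (not (andOr x)) , sym (force-keeps j x _) ∷ [] , andOr-flips j x
andOr-evasive x (_ ∷ _ ∷ _) (s≤s (s≤s ()))

-- The chain setting x₀, then x₂, then x₁ changes andOr at every step: 0, 1, 0, 1.
andOrRanking : Ranking 3
andOrRanking = record { rank = swap12 ; unrank = swap12 ; rank-unrank = swap12-involutive }
  where
  swap12 : Fin 3 → Fin 3
  swap12 0F = 0F
  swap12 1F = 2F
  swap12 2F = 1F
  swap12-involutive : ∀ t → swap12 (swap12 t) ≡ t
  swap12-involutive 0F = refl
  swap12-involutive 1F = refl
  swap12-involutive 2F = refl

andOr-alternating : FullyAlternating andOr andOrRanking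
andOr-alternating 0F ()
andOr-alternating 1F ()
andOr-alternating 2F ()

g : ∀ k → BoolFun (3 ^ k)
g zero    = dictator
g (suc k) = andOr ◇ g k

gRanking : ∀ k → Ranking (3 ^ k)
gRanking zero    = idRanking
gRanking (suc k) = andOrRanking ⊗ gRanking k

g-extensional : ∀ k → Extensional (g k)
g-extensional zero    = dictator-extensional
g-extensional (suc k) = ◇-extensional andOr-extensional (g-extensional k)

g-unanimous : ∀ k → Unanimous (g k)
g-unanimous zero    = dictator-unanimous
g-unanimous (suc k) = ◇-unanimous {f = g k} andOr-extensional andOr-unanimous (g-unanimous k)

g-sensAt : ∀ k x → sensAt (g k) x ≤ 2 ^ k
g-sensAt zero    x = dictator-sensAt x
g-sensAt (suc k) x = begin
  sensAt (g (suc k)) x    ≤⟨ sensAt-◇ andOr-extensional (g-extensional k) (g-sensAt k) x ⟩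
  2 ^ k * sensAt andOr v  ≤⟨ *-monoʳ-≤ (2 ^ k) (andOr-sensAt v) ⟩
  2 ^ k * 2               ≡⟨ *-comm (2 ^ k) 2 ⟩
  2 ^ suc k               ∎
  where
  open ≤-Reasoning
  v : Input 3
  v j = g k (block j x)

g-evasive : ∀ k → Evasive (2 ^ k) (g k)
g-evasive zero    = dictator-evasive
g-evasive (suc k) = ◇-evasive andOr-extensional (g-extensional k) andOr-evasive (g-evasive k)

g-alt : ∀ k → altAlong (g k) (gRanking k) ≡ 3 ^ k
g-alt zero    = dictator-alt
g-alt (suc k) = trans (altAlong-◇ andOr-extensional (g-extensional k) (g-unanimous k)
                                   andOrRanking (gRanking k) andOr-alternating)
                      (cong (3 *_) (g-alt k))

n≤3^n : ∀ n → n ≤ 3 ^ n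
n≤3^n zero    = z≤n
n≤3^n (suc n) = ≤-trans (+-mono-≤ (m^n>0 3 n) (n≤3^n n)) (+-monoʳ-≤ (3 ^ n) (m≤m+n (3 ^ n) _))

theorem2 : Σ (ℕ → ℕ) λ nk → Σ ((k : ℕ) → BoolFun (nk k)) λ g →
    ((m : ℕ) → Σ ℕ λ K → (k : ℕ) → K ≤ k → m ≤ nk k)
    × ((k : ℕ) → Σ (Chain (nk k)) λ C → GeLogPow (altChain (g k) C) (sens (g k)) 5 3)
    × (Σ ℕ λ cn → Σ ℕ λ cd → 1 ≤ cn × 1 ≤ cd × Σ ℕ λ K → (k : ℕ) → K ≤ k →
         (t : DTree (nk k)) → Computes t (g k) → GeScaledLogPow (depth t) cn cd (nk k) 3 6)
theorem2 = (3 ^_) , g , unbounded , alternation , (1 , 1 , ≤-refl , ≤-refl , 0 , query-bound)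
  where
  unbounded : (m : ℕ) → Σ ℕ λ K → (k : ℕ) → K ≤ k → m ≤ 3 ^ k
  unbounded m = m , λ k m≤k → ≤-trans (n≤3^n m) (^-monoʳ-≤ 3 m≤k)
  -- s(g_k)^p ≤ (2^k)^p ≤ (3^k)^q = alt(g_k)^q whenever p/q ≤ log₃ 5 (≤ log₂ 3)
  alternation : (k : ℕ) → Σ (Chain (3 ^ k)) λ C → GeLogPow (altChain (g k) C) (sens (g k)) 5 3
  alternation k = rankChain (gRanking k) , λ p q _ _ 3ᵖ≤5ᵠ →
    power-sandwich 2 3 k p q (below-log₃5⇒below-log₂3 p q 3ᵖ≤5ᵠ) (sens-≤ {f = g k} (g-sensAt k))
                   (≤-reflexive (sym (trans (altChain-rankChain (g k) (gRanking k)) (g-alt k))))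
  -- (3^k)^p ≤ (2^k)^q ≤ depth^q whenever p/q ≤ log₆ 3 (≤ log₃ 2)
  query-bound : (k : ℕ) → 0 ≤ k → (t : DTree (3 ^ k)) → Computes t (g k) →
    GeScaledLogPow (depth t) 1 1 (3 ^ k) 3 6
  query-bound k _ t computes p q _ _ 6ᵖ≤3ᵠ = *-monoʳ-≤ (1 ^ q)
    (power-sandwich 3 2 k p q (below-log₆3⇒below-log₃2 p q 6ᵖ≤3ᵠ) ≤-refl (depth-≥ (g-evasive k) t computes))
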